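{- Let $\Gamma=K_{4,4}$ and let $G\leqslant\mathrm{Aut}(\Gamma)$ be transitive on vertices and edges with $G^+=\langle V_4\times V_4,\mathrm{Diag}(H\times H)\rangle$, where $H=\mathrm{Alt}(4)$ or $\mathrm{Sym}(4)$. Then $D(G)=3$.
   Context: $D(G)$ is the smallest $k$ such that there is a partition of the vertex set into $k$ parts whose setwise stabilisers in $G$ intersect trivially. The parts are $\Delta=\{v_1,\dots,v_4\}$, $\Delta'=\{u_1,\dots,u_4\}$; $(g,g')\in\mathrm{Sym}(4)\times\mathrm{Sym}(4)$ acts by $v_i\mapsto v_{i^g}$, $u_i\mapsto u_{i^{g'}}$. $G^+$ is the index-two subgroup of $G$ preserving each part, $\mathrm{Diag}(H\times H)=\{(h,h):h\in H\}$, and $V_4$ is the Klein four-group $\{\mathrm{id},(1,2)(3,4),(1,3)(2,4),(1,4)(2,3)\}$. -}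

module Defs where

open import Data.Nat using (ℕ; zero; suc; _<_; _%_)
open import Data.Fin using (Fin; zero; suc) renaming (_<_ to _<ᶠ_; _>_ to _>ᶠ_)
open import Data.Fin.Properties using () renaming (_<?_ to _<ᶠ?_)
open import Data.List using (List; length; filter; allFin; concatMap; map)
open import Data.Product using (Σ; ∃; _×_; _,_; proj₁)
open import Data.Sum using (_⊎_)
open import Data.Unit using (⊤)
open import Relation.Nullary using (¬_; Dec)
open import Relation.Nullary.Decidable using (_×-dec_)
open import Relation.Binary.PropositionalEquality using (_≡_; _≢_)
open import Function.Bundles using (_↔_; Inverse)
open import Function.Construct.Composition using (_↔-∘_)
open import Function.Construct.Identity using (↔-id)
open import Function.Construct.Symmetry using (↔-sym)

-- The graph Γ = K_{4,4}
-- Vertices are pairs (s , i): side s = zero is Δ = {v_1..v_4},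
-- side s = suc zero is Δ' = {u_1..u_4}; i : Fin 4 is the index.

V : Set
V = Fin 2 × Fin 4

Adj : V → V → Set
Adj (s , _) (t , _) = s ≢ t

Perm : Set
Perm = V ↔ V

app : Perm → V → V
app σ = Inverse.to σ

_≈ₚ_ : Perm → Perm → Set
σ ≈ₚ τ = ∀ v → app σ v ≡ app τ v

IsAut : Perm → Set
IsAut σ = ∀ u v → (Adj u v → Adj (app σ u) (app σ v)) × (Adj (app σ u) (app σ v) → Adj u v)

record IsSubgroup (G : Perm → Set) : Set where
  field
    resp  : ∀ {σ τ} → σ ≈ₚ τ → G σ → G τ
    ident : G (↔-id V)
    comp  : ∀ {σ τ} → G σ → G τ → G (σ ↔-∘ τ)
    inver : ∀ {σ} → G σ → G (↔-sym σ)

data Gen (S : Perm → Set) : Perm → Set where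
  gen   : ∀ {σ} → S σ → Gen S σ
  ident : Gen S (↔-id V)
  comp  : ∀ {σ τ} → Gen S σ → Gen S τ → Gen S (σ ↔-∘ τ)
  inver : ∀ {σ} → Gen S σ → Gen S (↔-sym σ)
  resp  : ∀ {σ τ} → σ ≈ₚ τ → Gen S σ → Gen S τ

VertexTransitive : (Perm → Set) → Set
VertexTransitive G = ∀ v w → Σ Perm λ σ → G σ × app σ v ≡ w

EdgeTransitive : (Perm → Set) → Set
EdgeTransitive G = ∀ u v u' v' → Adj u v → Adj u' v' →
  Σ Perm λ σ → G σ ×
    ((app σ u ≡ u' × app σ v ≡ v') ⊎ (app σ u ≡ v' × app σ v ≡ u'))

PreservesParts : Perm → Set
PreservesParts σ = ∀ v → proj₁ (app σ v) ≡ proj₁ v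

ActsAsPair : (Fin 4 → Fin 4) → (Fin 4 → Fin 4) → Perm → Set
ActsAsPair g g' σ = ∀ i → (app σ (zero , i) ≡ (zero , g i)) × (app σ (suc zero , i) ≡ (suc zero , g' i))

v4a v4b v4c : Fin 4 → Fin 4
-- (1,2)(3,4)
v4a zero = suc zero
v4a (suc zero) = zero
v4a (suc (suc zero)) = suc (suc (suc zero))
v4a (suc (suc (suc zero))) = suc (suc zero)
-- (1,3)(2,4)
v4b zero = suc (suc zero)
v4b (suc zero) = suc (suc (suc zero))
v4b (suc (suc zero)) = zero
v4b (suc (suc (suc zero))) = suc zero
-- (1,4)(2,3)
v4c zero = suc (suc (suc zero))
v4c (suc zero) = suc (suc zero)
v4c (suc (suc zero)) = suc zero
v4c (suc (suc (suc zero))) = zero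

_≗₄_ : (Fin 4 → Fin 4) → (Fin 4 → Fin 4) → Set
f ≗₄ g = ∀ i → f i ≡ g i

InV4 : (Fin 4 → Fin 4) → Set
InV4 g = (g ≗₄ (λ i → i)) ⊎ (g ≗₄ v4a) ⊎ (g ≗₄ v4b) ⊎ (g ≗₄ v4c)

inversions : (Fin 4 → Fin 4) → ℕ
inversions g = length (filter (λ p → (proj₁ p <ᶠ? Data.Product.proj₂ p) ×-dec (g (Data.Product.proj₂ p) <ᶠ? g (proj₁ p)))
                              (concatMap (λ i → map (λ j → (i , j)) (allFin 4)) (allFin 4)))

-- even permutation (a permutation lies in Alt(4) iff it has an even number of inversions)
IsEven : (Fin 4 → Fin 4) → Set
IsEven g = inversions g % 2 ≡ 0

data HChoice : Set where
  Alt4 Sym4 : HChoice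

InH : HChoice → (Fin 4 → Fin 4) → Set
InH Alt4 g = IsEven g
InH Sym4 g = ⊤

Generators : HChoice → Perm → Set
Generators H σ = Σ (Fin 4 → Fin 4) λ g → Σ (Fin 4 → Fin 4) λ g' →
  ((InV4 g × InV4 g') ⊎ (InH H g × g ≗₄ g')) × ActsAsPair g g' σ

-- G^+ (elements of G preserving each part) equals ⟨V_4 × V_4, Diag(H × H)⟩
GPlusIs : (Perm → Set) → HChoice → Set
GPlusIs G H = ∀ σ → ((G σ × PreservesParts σ) → Gen (Generators H) σ)
                  × (Gen (Generators H) σ → (G σ × PreservesParts σ))

-- a partition of V into k (nonempty) parts, given by the part-map c
IsPartition : (k : ℕ) → (V → Fin k) → Set
IsPartition k c = ∀ j → Σ V λ v → c v ≡ j

StabilisesPart : {k : ℕ} → (V → Fin k) → Fin k → Perm → Set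
StabilisesPart c j σ = ∀ v → (c v ≡ j → c (app σ v) ≡ j) × (c (app σ v) ≡ j → c v ≡ j)

Distinguishing : (Perm → Set) → (k : ℕ) → (V → Fin k) → Set
Distinguishing G k c = ∀ σ → G σ → (∀ j → StabilisesPart c j σ) → ∀ v → app σ v ≡ v

HasDistPartition : (Perm → Set) → ℕ → Set
HasDistPartition G k = Σ (V → Fin k) λ c → IsPartition k c × Distinguishing G k c

DistNumberIs : (Perm → Set) → ℕ → Set
DistNumberIs G k = HasDistPartition G k × (∀ m → m < k → ¬ HasDistPartition G m)

{-# OPTIONS --safe #-}
-- Identify Fin 4 with the Klein four-group 𝔽₂², written ⊕, so that V₄ acts by translations and
-- i ⊕ j is the translation carrying i to j.  Sym(4) acts on V₄ by conjugation with kernel V₄, so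
-- every side-preserving (g , g') in ⟨V₄ × V₄, Diag(H × H)⟩ has g V₄ = g' V₄: g and g' conjugate
-- V₄ alike.
--
-- D(G) ≤ 3: the partition {v₀, v₁, u₀}, {v₂, u₁, u₂}, {v₃, u₃} is stabilised only by automorphisms
-- preserving Δ and Δ', that is by pairs (g , g') with g fixing v₂, v₃ and g' fixing u₀, u₃.  Then g commutes with the translation
-- v₂ ↦ v₃, hence so does g', which therefore also fixes u₁ and u₂; symmetrically g fixes v₀, v₁.
--
-- D(G) > 2: a 2-colouring of four points is preserved by a non-trivial translation unless it is
-- constant off one point.  If neither side of a 2-colouring of Γ has such a translation, take a
-- 3-cycle ρ ∈ Alt(4) fixing the odd point of Δ, paired with the element of ρ V₄ fixing the odd
-- point of Δ'.
module Submission where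

open import Defs
open import Data.Nat using (ℕ; _<_; s≤s⁻¹)
import Data.Nat as ℕ
open import Data.Fin using (Fin; inject≤)
open import Data.Fin.Patterns using (0F; 1F; 2F; 3F)
open import Data.Fin.Properties using (_≟_; all?; any?; inject≤-injective)
open import Data.Fin.Permutation using (Permutation′; permutation; transpose; _⟨$⟩ʳ_)
open import Data.List using ([]; _∷_)
open import Data.List.Relation.Unary.All using ([]; _∷_)
open import Data.List.Relation.Unary.AllPairs using ([]; _∷_)
open import Data.List.Relation.Unary.Unique.Propositional using (Unique)
open import Data.List.Relation.Unary.Unique.Propositional.Properties using (map⁺)
open import Data.List.Relation.Unary.Unique.DecPropositional (_≟_ {4}) using (unique?)
open import Data.Vec using (lookup; _∷_; [])
open import Data.Vec.Properties using (lookup∘tabulate)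
open import Data.Product using (Σ-syntax; _×_; _,_; proj₁; proj₂)
open import Data.Sum using (_⊎_; inj₁; inj₂)
open import Data.Unit using (tt)
open import Function using (_∘_; _⇔_; _↔_; Inverse; Equivalence; Injection; Injective; mk⇔; mk↔ₛ′)
open import Function.Construct.Composition using (_↔-∘_; _⇔-∘_)
open import Function.Construct.Identity using (⇔-id)
open import Function.Construct.Symmetry using (↔-sym; ⇔-sym)
open import Function.Properties.Inverse using (↔⇒↣)
open import Relation.Nullary using (¬_; Dec; yes; no; contradiction)
open import Relation.Nullary.Decidable
  using (from-yes; decidable-stable; ¬?; _×-dec_; _⊎-dec_; _→-dec_)
open import Relation.Binary.PropositionalEquality
  using (_≡_; _≢_; refl; sym; trans; cong; cong₂; module ≡-Reasoning)

private
  variable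
    k : ℕ
    a b c : Fin 4
    f f' g g' h : Fin 4 → Fin 4
    σ τ : Perm
    H : HChoice

↔-injective : ∀ {A B : Set} (π : A ↔ B) → Injective _≡_ _≡_ (Inverse.to π)
↔-injective π = Injection.injective (↔⇒↣ π)

infixl 6 _⊕_

_⊕_ : Fin 4 → Fin 4 → Fin 4
0F ⊕ i = i
1F ⊕ i = v4a i
2F ⊕ i = v4b i
3F ⊕ i = v4c i

⊕-InV4 : ∀ x → InV4 (x ⊕_)
⊕-InV4 0F = inj₁ λ _ → refl
⊕-InV4 1F = inj₂ (inj₁ λ _ → refl)
⊕-InV4 2F = inj₂ (inj₂ (inj₁ λ _ → refl))
⊕-InV4 3F = inj₂ (inj₂ (inj₂ λ _ → refl))

InV4⇒⊕ : InV4 g → Σ[ x ∈ Fin 4 ] g ≗₄ (x ⊕_)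
InV4⇒⊕ (inj₁ e) = 0F , e
InV4⇒⊕ (inj₂ (inj₁ e)) = 1F , e
InV4⇒⊕ (inj₂ (inj₂ (inj₁ e))) = 2F , e
InV4⇒⊕ (inj₂ (inj₂ (inj₂ e))) = 3F , e

⊕-identityʳ : ∀ i → i ⊕ 0F ≡ i
⊕-identityʳ = from-yes (all? λ i → i ⊕ 0F ≟ i)

⊕-cancelˡ : ∀ x i → x ⊕ (x ⊕ i) ≡ i
⊕-cancelˡ = from-yes (all? λ x → all? λ i → x ⊕ (x ⊕ i) ≟ i)

⊕-translation : ∀ x i j → (x ⊕ i) ⊕ (x ⊕ j) ≡ i ⊕ j
⊕-translation = from-yes (all? λ x → all? λ i → all? λ j → (x ⊕ i) ⊕ (x ⊕ j) ≟ i ⊕ j)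

⊕-cancel₁₂ : ∀ i j → i ⊕ i ⊕ j ≡ j
⊕-cancel₁₂ = from-yes (all? λ i → all? λ j → i ⊕ i ⊕ j ≟ j)

⊕-cancel₁₃ : ∀ i j → i ⊕ j ⊕ i ≡ j
⊕-cancel₁₃ = from-yes (all? λ i → all? λ j → i ⊕ j ⊕ i ≟ j)

⊕-cancel₂₃ : ∀ i j → i ⊕ j ⊕ j ≡ i
⊕-cancel₂₃ = from-yes (all? λ i → all? λ j → i ⊕ j ⊕ j ≟ i)

⊕-split : ∀ i j k → i ⊕ j ≡ k ⊕ (i ⊕ j ⊕ k)
⊕-split = from-yes (all? λ i → all? λ j → all? λ k → i ⊕ j ≟ k ⊕ (i ⊕ j ⊕ k))

⊕₃-fresh : ∀ i j k → Unique (i ∷ j ∷ k ∷ []) → Unique (i ⊕ j ⊕ k ∷ i ∷ j ∷ k ∷ [])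
⊕₃-fresh = from-yes (all? λ i → all? λ j → all? λ k →
  unique? (i ∷ j ∷ k ∷ []) →-dec unique? (i ⊕ j ⊕ k ∷ i ∷ j ∷ k ∷ []))

⊕₃-fourth : ∀ i j k l → Unique (l ∷ i ∷ j ∷ k ∷ []) → i ⊕ j ⊕ k ≡ l
⊕₃-fourth = from-yes (all? λ i → all? λ j → all? λ k → all? λ l →
  unique? (l ∷ i ∷ j ∷ k ∷ []) →-dec i ⊕ j ⊕ k ≟ l)

⊕-sum⇔ : ∀ i j k l → (i ⊕ j ≡ k ⊕ l) ⇔ (i ⊕ j ⊕ k ≡ l)
⊕-sum⇔ i j k l = mk⇔ (λ e → trans (cong (_⊕ k) e) (⊕-cancel₁₃ k l))
                     (λ e → trans (⊕-split i j k) (cong (k ⊕_) e))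

-- i ⊕ j ⊕ k is the point left over when two of i, j, k coincide, and the fourth point when they
-- are distinct; either description is preserved by every permutation (Sym(4) = AGL(2,2)).
⊕₃-natural : Injective _≡_ _≡_ h → ∀ i j k → h (i ⊕ j ⊕ k) ≡ h i ⊕ h j ⊕ h k
⊕₃-natural {h} inj i j k with i ≟ j | i ≟ k | j ≟ k
... | yes refl | _ | _ = trans (cong h (⊕-cancel₁₂ i k)) (sym (⊕-cancel₁₂ (h i) (h k)))
... | no _ | yes refl | _ = trans (cong h (⊕-cancel₁₃ i j)) (sym (⊕-cancel₁₃ (h i) (h j)))
... | no _ | no _ | yes refl = trans (cong h (⊕-cancel₂₃ i j)) (sym (⊕-cancel₂₃ (h i) (h j)))
... | no i≢j | no i≢k | no j≢k =
  sym (⊕₃-fourth _ _ _ _ (map⁺ inj (⊕₃-fresh i j k ((i≢j ∷ i≢k ∷ []) ∷ (j≢k ∷ []) ∷ [] ∷ []))))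

-- g and g' act alike on V₄ by conjugation; for permutations this means g V₄ = g' V₄.
SameConjugation : (Fin 4 → Fin 4) → (Fin 4 → Fin 4) → Set
SameConjugation g g' = ∀ i j k l → (g i ⊕ g j ≡ g' k ⊕ g' l) ⇔ (i ⊕ j ≡ k ⊕ l)

sameConjugation-id : SameConjugation (λ i → i) (λ i → i)
sameConjugation-id i j k l = ⇔-id _

sameConjugation-resp : f ≗₄ g → f' ≗₄ g' → SameConjugation f f' → SameConjugation g g'
sameConjugation-resp e e' s i j k l
  rewrite sym (e i) | sym (e j) | sym (e' k) | sym (e' l) = s i j k l

sameConjugation-∘ : SameConjugation f f' → SameConjugation g g' → SameConjugation (g ∘ f) (g' ∘ f')
sameConjugation-∘ {f} {f'} sf sg i j k l = sf i j k l ⇔-∘ sg (f i) (f j) (f' k) (f' l)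

sameConjugation-inverse : SameConjugation f f' → (∀ i → f (g i) ≡ i) → (∀ i → f' (g' i) ≡ i) →
                          SameConjugation g g'
sameConjugation-inverse {g = g} {g' = g'} s fg f'g' i j k l =
  sameConjugation-resp (sym ∘ fg) (sym ∘ f'g') sameConjugation-id i j k l
    ⇔-∘ ⇔-sym (s (g i) (g j) (g' k) (g' l))

sameConjugation-sym : SameConjugation g g' → SameConjugation g' g
sameConjugation-sym s i j k l = ≡-flip ⇔-∘ (s k l i j ⇔-∘ ≡-flip)
  where
  ≡-flip : ∀ {x y : Fin 4} → (x ≡ y) ⇔ (y ≡ x)
  ≡-flip = mk⇔ sym sym

sameConjugation-V₄ : InV4 g → InV4 g' → SameConjugation g g'
sameConjugation-V₄ vg vg' with InV4⇒⊕ vg | InV4⇒⊕ vg'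
... | x , g≗x | y , g'≗y = sameConjugation-resp (sym ∘ g≗x) (sym ∘ g'≗y) translations
  where
  translations : SameConjugation (x ⊕_) (y ⊕_)
  translations i j k l rewrite ⊕-translation x i j | ⊕-translation y k l = ⇔-id _

sameConjugation-diagonal : Injective _≡_ _≡_ h → SameConjugation h h
sameConjugation-diagonal {h} inj i j k l =
  ⇔-sym (⊕-sum⇔ i j k l) ⇔-∘ (cancel-h ⇔-∘ ⊕-sum⇔ (h i) (h j) (h k) (h l))
  where
  cancel-h : (h i ⊕ h j ⊕ h k ≡ h l) ⇔ (i ⊕ j ⊕ k ≡ l)
  cancel-h rewrite sym (⊕₃-natural inj i j k) = mk⇔ inj (cong h)

-- Fixing a and b, g commutes with the translation by a ⊕ b; hence so does g'.
sameConjugation-fixes : SameConjugation g g' → g a ≡ a → g b ≡ b → g' c ≡ c →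
                        g' (c ⊕ (a ⊕ b)) ≡ c ⊕ (a ⊕ b)
sameConjugation-fixes {g} {g'} {a} {b} {c} s ga gb g'c = begin
  g' l                ≡⟨ sym (⊕-cancelˡ c (g' l)) ⟩
  c ⊕ (c ⊕ g' l)      ≡⟨ cong (λ x → c ⊕ (x ⊕ g' l)) (sym g'c) ⟩
  c ⊕ (g' c ⊕ g' l)   ≡⟨ cong (c ⊕_) (sym (Equivalence.from (s a b c l) l-translated)) ⟩
  c ⊕ (g a ⊕ g b)     ≡⟨ cong (c ⊕_) (cong₂ _⊕_ ga gb) ⟩
  c ⊕ (a ⊕ b)         ∎
  where
  open ≡-Reasoning
  l = c ⊕ (a ⊕ b)
  l-translated : a ⊕ b ≡ c ⊕ l
  l-translated = sym (⊕-cancelˡ c (a ⊕ b))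

side : Perm → Fin 2 → Fin 4 → Fin 4
side σ s i = proj₂ (app σ (s , i))

side-app : ∀ σ → PreservesParts σ → ∀ s i → app σ (s , i) ≡ (s , side σ s i)
side-app σ pp s i = cong (_, side σ s i) (pp (s , i))

side-injective : ∀ σ → PreservesParts σ → ∀ s → Injective _≡_ _≡_ (side σ s)
side-injective σ pp s {i} {j} e =
  cong proj₂ (↔-injective σ (trans (side-app σ pp s i)
                                   (trans (cong (s ,_) e) (sym (side-app σ pp s j)))))

SameV₄Coset : Perm → Set
SameV₄Coset σ = PreservesParts σ × SameConjugation (side σ 0F) (side σ 1F)

sameV₄Coset-∘ : SameV₄Coset σ → SameV₄Coset τ → SameV₄Coset (σ ↔-∘ τ)
sameV₄Coset-∘ {σ} {τ} (ppσ , sσ) (ppτ , sτ) =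
  pp , sameConjugation-resp (sym ∘ ∘-side 0F) (sym ∘ ∘-side 1F)
         (sameConjugation-∘ {side τ 0F} {side τ 1F} {side σ 0F} {side σ 1F} sτ sσ)
  where
  pp : PreservesParts (σ ↔-∘ τ)
  pp v = trans (ppσ (app τ v)) (ppτ v)
  ∘-side : ∀ s i → side (σ ↔-∘ τ) s i ≡ side σ s (side τ s i)
  ∘-side s i = cong (proj₂ ∘ app σ) (side-app τ ppτ s i)

sameV₄Coset-sym : SameV₄Coset σ → SameV₄Coset (↔-sym σ)
sameV₄Coset-sym {σ} (pp , s) = pp⁻¹ ,
  sameConjugation-inverse {side σ 0F} {side σ 1F} s (side-inverse 0F) (side-inverse 1F)
  where
  pp⁻¹ : PreservesParts (↔-sym σ)
  pp⁻¹ v = trans (sym (pp (Inverse.from σ v))) (cong proj₁ (Inverse.strictlyInverseˡ σ v))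
  side-inverse : ∀ s i → side σ s (side (↔-sym σ) s i) ≡ i
  side-inverse s i = trans (cong (proj₂ ∘ app σ) (sym (side-app (↔-sym σ) pp⁻¹ s i)))
                           (cong proj₂ (Inverse.strictlyInverseˡ σ (s , i)))

sameV₄Coset-resp : σ ≈ₚ τ → SameV₄Coset σ → SameV₄Coset τ
sameV₄Coset-resp e (pp , s) = (λ v → trans (cong proj₁ (sym (e v))) (pp v)) ,
  sameConjugation-resp (λ i → cong proj₂ (e (0F , i))) (λ i → cong proj₂ (e (1F , i))) s

generator-sameV₄Coset : Generators H σ → SameV₄Coset σ
generator-sameV₄Coset {H} {σ} (g , g' , kind , acts) =
  pp , sameConjugation-resp (sym ∘ on₀) (sym ∘ on₁) (sameConjugation kind)
  where
  pp : PreservesParts σ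
  pp (0F , i) = cong proj₁ (proj₁ (acts i))
  pp (1F , i) = cong proj₁ (proj₂ (acts i))
  on₀ : side σ 0F ≗₄ g
  on₀ i = cong proj₂ (proj₁ (acts i))
  on₁ : side σ 1F ≗₄ g'
  on₁ i = cong proj₂ (proj₂ (acts i))
  g-injective : Injective _≡_ _≡_ g
  g-injective {i} {j} e = side-injective σ pp 0F (trans (on₀ i) (trans e (sym (on₀ j))))
  sameConjugation : (InV4 g × InV4 g') ⊎ (InH H g × g ≗₄ g') → SameConjugation g g'
  sameConjugation (inj₁ (vg , vg')) = sameConjugation-V₄ vg vg'
  sameConjugation (inj₂ (_ , g≗g')) =
    sameConjugation-resp {g} {g} (λ _ → refl) g≗g' (sameConjugation-diagonal g-injective)

generated-sameV₄Coset : Gen (Generators H) σ → SameV₄Coset σ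
generated-sameV₄Coset (gen {σ} p) = generator-sameV₄Coset {σ = σ} p
generated-sameV₄Coset ident = (λ _ → refl) , sameConjugation-id
generated-sameV₄Coset (comp {σ} {τ} p q) =
  sameV₄Coset-∘ {σ} {τ} (generated-sameV₄Coset p) (generated-sameV₄Coset q)
generated-sameV₄Coset (inver {σ} p) = sameV₄Coset-sym {σ} (generated-sameV₄Coset p)
generated-sameV₄Coset (resp {σ} {τ} e p) = sameV₄Coset-resp {σ} {τ} e (generated-sameV₄Coset p)

automorphism-preserves-sameSide : ∀ σ → IsAut σ → ∀ {u w} →
                                  proj₁ u ≡ proj₁ w → proj₁ (app σ u) ≡ proj₁ (app σ w)
automorphism-preserves-sameSide σ aut {u} {w} e =
  decidable-stable (proj₁ (app σ u) ≟ proj₁ (app σ w)) (λ adj → proj₂ (aut u w) adj e)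

≢-≢⇒≡ : ∀ (s t r : Fin 2) → s ≢ r → t ≢ r → s ≡ t
≢-≢⇒≡ = from-yes (all? λ (s : Fin 2) → all? λ t → all? λ r →
  ¬? (s ≟ r) →-dec ¬? (t ≟ r) →-dec s ≟ t)

automorphism-preserves-sides : ∀ σ → IsAut σ → ∀ {v} → proj₁ (app σ v) ≡ proj₁ v → PreservesParts σ
automorphism-preserves-sides σ aut {v} stays w with proj₁ w ≟ proj₁ v
... | yes same = trans (automorphism-preserves-sameSide σ aut same) (trans stays (sym same))
... | no differ = ≢-≢⇒≡ _ _ _ (λ e → proj₁ (aut w v) differ (trans e (sym stays))) differ

side-identity : ∀ σ → PreservesParts σ → (∀ s i → side σ s i ≡ i) → ∀ v → app σ v ≡ v
side-identity σ pp fixes (s , i) = trans (side-app σ pp s i) (cong (s ,_) (fixes s i))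

fixes-lone-vertex : ∀ σ (c : V → Fin k) → PreservesParts σ → (∀ v → c (app σ v) ≡ c v) →
                    ∀ {s p} → (∀ i → c (s , i) ≡ c (s , p) → i ≡ p) → side σ s p ≡ p
fixes-lone-vertex σ c pp preserves {s} {p} lone =
  lone _ (trans (cong c (sym (side-app σ pp s p))) (preserves (s , p)))

col : V → Fin 3
col (0F , 0F) = 0F
col (0F , 1F) = 0F
col (0F , 2F) = 1F
col (0F , 3F) = 2F
col (1F , 0F) = 0F
col (1F , 1F) = 1F
col (1F , 2F) = 1F
col (1F , 3F) = 2F

col-partition : IsPartition 3 col
col-partition 0F = (0F , 0F) , refl
col-partition 1F = (0F , 2F) , refl
col-partition 2F = (0F , 3F) , refl

-- The part of v₀ and v₁ meets Δ' only in u₀, so v₀ and v₁, which must stay on a common side,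
-- cannot be moved to Δ'.
col-automorphism-preserves-sides : ∀ σ → IsAut σ → (∀ v → col (app σ v) ≡ col v) → PreservesParts σ
col-automorphism-preserves-sides σ aut preserves = automorphism-preserves-sides σ aut v₀-stays
  where
  only-u₀ : ∀ w → proj₁ w ≡ 1F → col w ≡ 0F → w ≡ (1F , 0F)
  only-u₀ (1F , 0F) _ _ = refl
  only-u₀ (1F , 1F) _ ()
  only-u₀ (1F , 2F) _ ()
  only-u₀ (1F , 3F) _ ()
  v₀-stays : proj₁ (app σ (0F , 0F)) ≡ 0F
  v₀-stays with proj₁ (app σ (0F , 0F)) in moved
  ... | 0F = refl
  ... | 1F = contradiction (↔-injective σ (trans (only-u₀ _ moved (preserves _))
                                                 (sym (only-u₀ _ moved′ (preserves _))))) λ ()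
    where
    moved′ : proj₁ (app σ (0F , 1F)) ≡ 1F
    moved′ = trans (sym (automorphism-preserves-sameSide σ aut {0F , 0F} {0F , 1F} refl)) moved

col-distinguishing : ∀ {G} → (∀ σ → G σ → IsAut σ) → GPlusIs G H → Distinguishing G 3 col
col-distinguishing aut gplus σ gσ stabilises = side-identity σ pp fixes
  where
  preserves : ∀ v → col (app σ v) ≡ col v
  preserves v = proj₁ (stabilises (col v) v) refl
  pp = col-automorphism-preserves-sides σ (aut σ gσ) preserves
  g₀ g₁ : Fin 4 → Fin 4
  g₀ = side σ 0F
  g₁ = side σ 1F
  conj : SameConjugation g₀ g₁
  conj = proj₂ (generated-sameV₄Coset (proj₁ (gplus σ) (gσ , pp)))
  conj⁻¹ : SameConjugation g₁ g₀
  conj⁻¹ = sameConjugation-sym {g₀} {g₁} conj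
  fixes-v₂ : side σ 0F 2F ≡ 2F
  fixes-v₂ = fixes-lone-vertex σ col pp preserves λ { 2F _ → refl ; 0F () ; 1F () ; 3F () }
  fixes-v₃ : side σ 0F 3F ≡ 3F
  fixes-v₃ = fixes-lone-vertex σ col pp preserves λ { 3F _ → refl ; 0F () ; 1F () ; 2F () }
  fixes-u₀ : side σ 1F 0F ≡ 0F
  fixes-u₀ = fixes-lone-vertex σ col pp preserves λ { 0F _ → refl ; 1F () ; 2F () ; 3F () }
  fixes-u₃ : side σ 1F 3F ≡ 3F
  fixes-u₃ = fixes-lone-vertex σ col pp preserves λ { 3F _ → refl ; 0F () ; 1F () ; 2F () }
  fixes : ∀ s i → side σ s i ≡ i
  fixes 0F 0F = sameConjugation-fixes {g₁} {g₀} conj⁻¹ fixes-u₀ fixes-u₃ fixes-v₃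
  fixes 0F 1F = sameConjugation-fixes {g₁} {g₀} conj⁻¹ fixes-u₀ fixes-u₃ fixes-v₂
  fixes 0F 2F = fixes-v₂
  fixes 0F 3F = fixes-v₃
  fixes 1F 0F = fixes-u₀
  fixes 1F 1F = sameConjugation-fixes {g₀} {g₁} conj fixes-v₂ fixes-v₃ fixes-u₀
  fixes 1F 2F = sameConjugation-fixes {g₀} {g₁} conj fixes-v₂ fixes-v₃ fixes-u₃
  fixes 1F 3F = fixes-u₃

ConstantOff : Fin 4 → (Fin 4 → Fin 2) → Set
ConstantOff a c = ∀ i j → i ≢ a → j ≢ a → c i ≡ c j

HasV₄Symmetry : (Fin 4 → Fin 2) → Set
HasV₄Symmetry c = Σ[ x ∈ Fin 4 ] x ≢ 0F × (∀ i → c (x ⊕ i) ≡ c i)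

V₄SymmetricOrConstantOffAPoint : (Fin 4 → Fin 2) → Set
V₄SymmetricOrConstantOffAPoint c = HasV₄Symmetry c ⊎ Σ[ a ∈ Fin 4 ] ConstantOff a c

-- Colour classes of sizes 2 + 2 or 4 + 0 are swapped or fixed by a translation; sizes 3 + 1 leave
-- an odd point.
two-colouring-of-four : ∀ c → V₄SymmetricOrConstantOffAPoint c
two-colouring-of-four c = transport (lookup∘tabulate c) (every-table (c 0F) (c 1F) (c 2F) (c 3F))
  where
  classify? : ∀ d → Dec (V₄SymmetricOrConstantOffAPoint d)
  classify? d = any? (λ x → ¬? (x ≟ 0F) ×-dec all? λ i → d (x ⊕ i) ≟ d i)
         ⊎-dec any? (λ a → all? λ i → all? λ j → ¬? (i ≟ a) →-dec ¬? (j ≟ a) →-dec d i ≟ d j)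
  every-table : ∀ c₀ c₁ c₂ c₃ → V₄SymmetricOrConstantOffAPoint (lookup (c₀ ∷ c₁ ∷ c₂ ∷ c₃ ∷ []))
  every-table = from-yes (all? λ c₀ → all? λ c₁ → all? λ c₂ → all? λ c₃ →
    classify? (lookup (c₀ ∷ c₁ ∷ c₂ ∷ c₃ ∷ [])))
  transport : ∀ {d} → (∀ i → d i ≡ c i) →
              V₄SymmetricOrConstantOffAPoint d → V₄SymmetricOrConstantOffAPoint c
  transport e (inj₁ (x , x≢0 , inv)) =
    inj₁ (x , x≢0 , λ i → trans (sym (e (x ⊕ i))) (trans (inv i) (e i)))
  transport e (inj₂ (a , const)) =
    inj₂ (a , λ i j i≢a j≢a → trans (sym (e i)) (trans (const i j i≢a j≢a) (e j)))

constantOff-preserved : ∀ {c : Fin 4 → Fin 2} → ConstantOff a c → Injective _≡_ _≡_ h → h a ≡ a →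
                        ∀ i → c (h i) ≡ c i
constantOff-preserved {a} {h} {c} const inj ha≡a i with i ≟ a
... | yes refl = cong c ha≡a
... | no i≢a = const (h i) i (λ hi≡a → i≢a (inj (trans hi≡a (sym ha≡a)))) i≢a

sidewise : Permutation′ 4 → Permutation′ 4 → Perm
sidewise π π' =
  mk↔ₛ′ (act (π ⟨$⟩ʳ_) (π' ⟨$⟩ʳ_)) (act (Inverse.from π) (Inverse.from π')) inverseˡ inverseʳ
  where
  act : (Fin 4 → Fin 4) → (Fin 4 → Fin 4) → V → V
  act g g' (0F , i) = 0F , g i
  act g g' (1F , i) = 1F , g' i
  inverseˡ : ∀ v → act (π ⟨$⟩ʳ_) (π' ⟨$⟩ʳ_) (act (Inverse.from π) (Inverse.from π') v) ≡ v
  inverseˡ (0F , i) = cong (0F ,_) (Inverse.strictlyInverseˡ π i)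
  inverseˡ (1F , i) = cong (1F ,_) (Inverse.strictlyInverseˡ π' i)
  inverseʳ : ∀ v → act (Inverse.from π) (Inverse.from π') (act (π ⟨$⟩ʳ_) (π' ⟨$⟩ʳ_) v) ≡ v
  inverseʳ (0F , i) = cong (0F ,_) (Inverse.strictlyInverseʳ π i)
  inverseʳ (1F , i) = cong (1F ,_) (Inverse.strictlyInverseʳ π' i)

translation : Fin 4 → Permutation′ 4
translation x = permutation (x ⊕_) (x ⊕_) (⊕-cancelˡ x) (⊕-cancelˡ x)

rotation : Fin 4 → Permutation′ 4
rotation a = transpose (a ⊕ 1F) (a ⊕ 2F) ↔-∘ transpose (a ⊕ 1F) (a ⊕ 3F)

rotation-fixes : ∀ a → rotation a ⟨$⟩ʳ a ≡ a
rotation-fixes = from-yes (all? λ a → rotation a ⟨$⟩ʳ a ≟ a)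

rotation-moves : ∀ a → rotation a ⟨$⟩ʳ (a ⊕ 1F) ≢ a ⊕ 1F
rotation-moves = from-yes (all? λ a → ¬? (rotation a ⟨$⟩ʳ (a ⊕ 1F) ≟ a ⊕ 1F))

rotation-even : ∀ a → IsEven (rotation a ⟨$⟩ʳ_)
rotation-even = from-yes (all? λ a → inversions (rotation a ⟨$⟩ʳ_) ℕ.% 2 ℕ.≟ 0)

translations-generated : ∀ x y → Gen (Generators H) (sidewise (translation x) (translation y))
translations-generated x y = gen (x ⊕_ , y ⊕_ , inj₁ (⊕-InV4 x , ⊕-InV4 y) , λ _ → refl , refl)

rotations-generated : ∀ H a → Gen (Generators H) (sidewise (rotation a) (rotation a))
rotations-generated Alt4 a = gen (_ , _ , inj₂ (rotation-even a , λ _ → refl) , λ _ → refl , refl)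
rotations-generated Sym4 a = gen (_ , _ , inj₂ (tt , λ _ → refl) , λ _ → refl , refl)

NontrivialSymmetry : (Perm → Set) → (V → Fin k) → Set
NontrivialSymmetry S c = Σ[ σ ∈ Perm ] S σ × (∀ v → c (app σ v) ≡ c v) × Σ[ v ∈ V ] app σ v ≢ v

nontrivialSymmetry-not-distinguishing : ∀ {S G} {c : V → Fin k} → (∀ {σ} → S σ → G σ) →
                                        NontrivialSymmetry S c → ¬ Distinguishing G k c
nontrivialSymmetry-not-distinguishing {c = c} S⊆G (σ , sσ , preserves , v , moved) distinguishing =
  moved (distinguishing σ (S⊆G sσ) stabilises v)
  where
  stabilises : ∀ j → StabilisesPart c j σ
  stabilises j w = trans (preserves w) , trans (sym (preserves w))

nontrivialSymmetry-coarsen : ∀ {m S} {c : V → Fin k} {ι : Fin k → Fin m} → Injective _≡_ _≡_ ι →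
                             NontrivialSymmetry S (ι ∘ c) → NontrivialSymmetry S c
nontrivialSymmetry-coarsen inj (σ , sσ , preserves , moved) = σ , sσ , inj ∘ preserves , moved

sidewise-symmetry : ∀ {S} {c : V → Fin 2} {π π'} → S (sidewise π π') →
                    (∀ i → c (0F , π ⟨$⟩ʳ i) ≡ c (0F , i)) →
                    (∀ i → c (1F , π' ⟨$⟩ʳ i) ≡ c (1F , i)) →
                    (Σ[ i ∈ Fin 4 ] π ⟨$⟩ʳ i ≢ i) ⊎ (Σ[ i ∈ Fin 4 ] π' ⟨$⟩ʳ i ≢ i) →
                    NontrivialSymmetry S c
sidewise-symmetry {c = c} {π} {π'} sσ on-Δ on-Δ' moves =
  sidewise π π' , sσ , preserves , moved moves
  where
  preserves : ∀ v → c (app (sidewise π π') v) ≡ c v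
  preserves (0F , i) = on-Δ i
  preserves (1F , i) = on-Δ' i
  moved : (Σ[ i ∈ Fin 4 ] π ⟨$⟩ʳ i ≢ i) ⊎ (Σ[ i ∈ Fin 4 ] π' ⟨$⟩ʳ i ≢ i) →
          Σ[ v ∈ V ] app (sidewise π π') v ≢ v
  moved (inj₁ (i , πi≢i)) = (0F , i) , πi≢i ∘ cong proj₂
  moved (inj₂ (i , π'i≢i)) = (1F , i) , π'i≢i ∘ cong proj₂

two-colouring-symmetry : ∀ H (c : V → Fin 2) → NontrivialSymmetry (Gen (Generators H)) c
two-colouring-symmetry H c = by-cases (two-colouring-of-four c₀) (two-colouring-of-four c₁)
  where
  c₀ c₁ : Fin 4 → Fin 2
  c₀ i = c (0F , i)
  c₁ i = c (1F , i)
  by-cases : V₄SymmetricOrConstantOffAPoint c₀ → V₄SymmetricOrConstantOffAPoint c₁ →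
             NontrivialSymmetry (Gen (Generators H)) c
  by-cases (inj₁ (x , x≢0 , invariant)) _ =
    sidewise-symmetry (translations-generated x 0F) invariant (λ _ → refl)
      (inj₁ (0F , x≢0 ∘ trans (sym (⊕-identityʳ x))))
  by-cases (inj₂ _) (inj₁ (y , y≢0 , invariant)) =
    sidewise-symmetry (translations-generated 0F y) (λ _ → refl) invariant
      (inj₂ (0F , y≢0 ∘ trans (sym (⊕-identityʳ y))))
  by-cases (inj₂ (a , constant-off-a)) (inj₂ (b , constant-off-b)) =
    sidewise-symmetry generated
      (constantOff-preserved constant-off-a (↔-injective ρ) (rotation-fixes a))
      (constantOff-preserved constant-off-b (↔-injective ρ') ρ'-fixes-b)
      (inj₁ (a ⊕ 1F , rotation-moves a))
    where
    ρ = rotation a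
    x = (ρ ⟨$⟩ʳ b) ⊕ b
    -- the element of the coset ρ V₄ that fixes b
    ρ' = translation x ↔-∘ ρ
    ρ'-fixes-b : ρ' ⟨$⟩ʳ b ≡ b
    ρ'-fixes-b = ⊕-cancel₁₃ (ρ ⟨$⟩ʳ b) b
    generated : Gen (Generators H) (sidewise ρ ρ')
    generated = resp (λ { (0F , i) → refl ; (1F , i) → refl })
                     (comp (translations-generated 0F x) (rotations-generated H a))

-- Only the description of G⁺ and the fact that G acts by automorphisms are needed.
proposition3p3 : (G : Perm → Set) → (H : HChoice) →
    IsSubgroup G → (∀ σ → G σ → IsAut σ) →
    VertexTransitive G → EdgeTransitive G → GPlusIs G H →
    DistNumberIs G 3
proposition3p3 G H _ aut _ _ gplus =
  (col , col-partition , col-distinguishing aut gplus) , fewer-parts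
  where
  fewer-parts : ∀ m → m < 3 → ¬ HasDistPartition G m
  fewer-parts m m<3 (c , _ , distinguishing) =
    nontrivialSymmetry-not-distinguishing (λ {σ} generated → proj₁ (proj₂ (gplus σ) generated))
      (nontrivialSymmetry-coarsen (λ {i} {j} → inject≤-injective m≤2 m≤2 i j)
        (two-colouring-symmetry H (λ v → inject≤ (c v) m≤2)))
      distinguishing
    where
    m≤2 = s≤s⁻¹ m<3
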